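{- Fix $k\geq 2$, and let $a=a(n)$, $s=s(n)$ be positive integers with $a=o(n)$, $s=o(n/a)$, $a,s\to\infty$, and additionally $a=\Omega(s\ln s)$. Partition $[n]$ into $a$ intervals of consecutive integers $I_1,\dots,I_a$ (in increasing order) of sizes as equal as possible, and let $$\mathcal{H}^n_{a,s}=\left\{ \{i_1, i_1+\ell, \dots, i_k, i_k+\ell\}: 1\leq \ell \leq s,\ \exists\, 1\leq b_1<\dots< b_k\leq a \text{ with } \{i_j, i_j+\ell\}\subseteq I_{b_j} \text{ for all } 1\leq j\leq k \right\}.$$ Then the transversal number of the pure complex whose set of facets is $\mathcal{H}^n_{a,s}$ is $n-\Theta(n/s)$.
   Context: The transversal number of a pure simplicial complex is the minimum size of a set of vertices meeting every facet. $f=n-\Theta(g)$ means $n-Cg\le f\le n-cg$ for all sufficiently large $n$, with positive constants $c,C$ independent of $n$; $a=\Omega(s\ln s)$ means $a\ge c\, s\ln s$ for a constant $c>0$. -}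

module Defs where

open import Data.Nat using (ℕ; zero; suc; _+_; _*_; _≤_; _<_)
open import Data.Nat.Logarithm using (⌊log₂_⌋)
open import Data.Fin using (Fin; toℕ)
open import Data.Fin.Subset using (Subset; _∈_; ∣_∣)
open import Data.Product using (Σ; ∃; _×_)
open import Data.Sum using (_⊎_)
open import Relation.Binary.PropositionalEquality using (_≡_)
open import Function.Bundles using (_⇔_)

-- Conventions: [n] is modelled as {0,…,n-1} (vertex v : Fin n is the
-- integer toℕ v + 1 of the paper); blocks I_1,…,I_a are indexed 0,…,a-1.

prefix : (ℕ → ℕ) → ℕ → ℕ
prefix f zero    = 0
prefix f (suc b) = prefix f b + f b

-- A partition of {0,…,n-1} into a intervals of consecutive integers, in
-- increasing order, with sizes as equal as possible: interval b (b < a) is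
-- [prefix size b , prefix size (b+1)), sizes sum to n, any two sizes differ
-- by at most one.
record EqualPartition (n a : ℕ) : Set where
  field
    size     : ℕ → ℕ
    total    : prefix size a ≡ n
    balanced : ∀ b b' → b < a → b' < a → size b ≤ suc (size b')

open EqualPartition public

InBlock : ∀ {n a} → EqualPartition n a → ℕ → ℕ → Set
InBlock P b i = prefix (size P) b ≤ i × i < prefix (size P) (suc b)

IsFacet : (k n a s : ℕ) → EqualPartition n a → Subset n → Set
IsFacet k n a s P F =
  Σ ℕ λ ℓ → 1 ≤ ℓ × ℓ ≤ s ×
  Σ (Fin k → ℕ) λ b → Σ (Fin k → ℕ) λ i →
    (∀ j j' → toℕ j < toℕ j' → b j < b j') ×
    (∀ j → b j < a) ×
    (∀ j → InBlock P (b j) (i j) × InBlock P (b j) (i j + ℓ)) ×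
    (∀ (v : Fin n) → (v ∈ F) ⇔ (∃ λ j → toℕ v ≡ i j ⊎ toℕ v ≡ i j + ℓ))

IsTransversal : (k n a s : ℕ) → EqualPartition n a → Subset n → Set
IsTransversal k n a s P T =
  ∀ F → IsFacet k n a s P F → ∃ λ (v : Fin n) → v ∈ F × v ∈ T

IsTransversalNumber : (k n a s : ℕ) → EqualPartition n a → ℕ → Set
IsTransversalNumber k n a s P t =
  (∃ λ T → IsTransversal k n a s P T × ∣ T ∣ ≡ t) ×
  (∀ T → IsTransversal k n a s P T → t ≤ ∣ T ∣)

Eventually : (ℕ → Set) → Set
Eventually P = Σ ℕ λ N → ∀ n → N ≤ n → P n

TendsToInfinity : (ℕ → ℕ) → Set
TendsToInfinity f = ∀ M → Eventually λ n → M ≤ f n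

-- f = o(g/h), i.e. f·h/g → 0 (with h = 1 this is f = o(g))
LittleOQuot : (f g h : ℕ → ℕ) → Set
LittleOQuot f g h = ∀ m → 1 ≤ m → Eventually λ n → m * f n * h n ≤ g n

-- a = Ω(s ln s), with ln replaced by ⌊log₂⌋ (equivalent up to the constant)
OmegaSLogS : (a s : ℕ → ℕ) → Set
OmegaSLogS a s = Σ ℕ λ d → 1 ≤ d × Eventually λ n → s n * ⌊log₂ (s n) ⌋ ≤ d * a n

-- Upper bound: every facet contains a pair {i, i + ℓ} with 1 ≤ ℓ ≤ s, so the vertices not
-- divisible by s + 1 form a transversal, which misses ⌊n/(s+1)⌋ vertices.
-- Lower bound: let W be the complement of a transversal.  For each distance ℓ ≤ s fewer than k
-- blocks contain two points of W at distance ℓ, since k such pairs in increasing blocks would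
-- form a facet disjoint from the transversal; so at most s(k-1) pairs (block, distance) are
-- realised by W.  The points of W in a window of s consecutive vertices of a block lie at
-- distinct distances from the first one, so cutting each block (of size ≤ Q s, where
-- Q = 1 + ⌊n/(as)⌋) into Q windows gives |W| ≤ Q (a + s(k-1)), which is O(n/s) since s ≤ d a.
module Submission where

open import Data.Bool.Base using (Bool; true; false; not; T)
open import Data.Bool.Properties using (T-≡; T-not-≡; T?; not-involutive)
open import Data.Empty using (⊥; ⊥-elim)
open import Data.Fin.Base using (Fin; zero; suc; toℕ; fromℕ<)
open import Data.Fin.Properties using (any?; toℕ-fromℕ<)
open import Data.Fin.Subset using (Subset; _∈_; ∣_∣)
open import Data.Nat.Base
open import Data.Nat.Properties
open import Algebra.Properties.CommutativeSemigroup +-commutativeSemigroup using (interchange)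
open import Data.Nat.DivMod using (_/_; _%_; m≡m%n+[m/n]*n; m%n<n; m/n*n≤m; m≥n⇒m/n>0)
open import Data.Nat.Divisibility
  using (_∣_; _∣?_; _∣0; ∣m+n∣m⇒∣n; ∣m∣n⇒∣m+n; ∣-refl; >⇒∤)
open import Data.Nat.Logarithm using (⌊log₂_⌋; ⌊log₂⌋-mono-≤)
open import Data.Nat.Tactic.RingSolver using (solve-∀)
open import Data.Product.Base using (Σ; ∃; _×_; _,_; proj₁; proj₂)
open import Data.Sum.Base using (_⊎_; inj₁; inj₂)
open import Data.Vec.Base using ([]; _∷_; lookup; tabulate)
open import Data.Vec.Properties using (lookup∘tabulate; []=⇒lookup; lookup⇒[]=)
import Data.Vec.Functional as Fun
open import Function.Base using (_∘_)
open import Function.Bundles using (_⇔_; mk⇔; Equivalence)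
open import Relation.Nullary.Decidable
  using (Dec; yes; no; ⌊_⌋; toWitness; fromWitness; _×-dec_; _⊎-dec_)
open import Relation.Binary.PropositionalEquality

open import Defs

open Equivalence using (to; from)

-- Counting the points of a Boolean predicate in an interval

indicator : Bool → ℕ
indicator false = 0
indicator true  = 1

indicator-mono : ∀ {b c} → (T b → T c) → indicator b ≤ indicator c
indicator-mono {false}         _   = z≤n
indicator-mono {true} {true}   _   = ≤-refl
indicator-mono {true} {false} b⇒c = ⊥-elim (b⇒c _)

count : (ℕ → Bool) → ℕ → ℕ → ℕ
count p x zero    = 0
count p x (suc l) = indicator (p x) + count p (suc x) l

count-shift : ∀ p x l → count p (suc x) l ≡ count (p ∘ suc) x l
count-shift p x zero    = refl
count-shift p x (suc l) = cong (indicator (p (suc x)) +_) (count-shift p (suc x) l)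

count-++ : ∀ p x l₁ l₂ → count p x (l₁ + l₂) ≡ count p x l₁ + count p (x + l₁) l₂
count-++ p x zero     l₂ = cong (λ y → count p y l₂) (sym (+-identityʳ x))
count-++ p x (suc l₁) l₂ rewrite +-suc x l₁ | count-++ p (suc x) l₁ l₂ =
  sym (+-assoc (indicator (p x)) _ _)

count-monoʳ-≤ : ∀ p x {l l′} → l ≤ l′ → count p x l ≤ count p x l′
count-monoʳ-≤ p x {l} {l′} l≤l′ = begin
  count p x l                            ≤⟨ m≤m+n _ _ ⟩
  count p x l + count p (x + l) (l′ ∸ l) ≡⟨ count-++ p x l (l′ ∸ l) ⟨
  count p x (l + (l′ ∸ l))               ≡⟨ cong (count p x) (m+[n∸m]≡n l≤l′) ⟩
  count p x l′                           ∎
  where open ≤-Reasoning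

count-mono : ∀ p q x y l → (∀ j → j < l → T (p (x + j)) → T (q (y + j))) →
             count p x l ≤ count q y l
count-mono p q x y zero    _      = z≤n
count-mono p q x y (suc l) p⇒q = +-mono-≤ (indicator-mono head) (count-mono p q (suc x) (suc y) l tail)
  where
  head : T (p x) → T (q y)
  head = subst (T ∘ q) (+-identityʳ y) ∘ p⇒q 0 z<s ∘ subst (T ∘ p) (sym (+-identityʳ x))
  tail : ∀ j → j < l → T (p (suc x + j)) → T (q (suc y + j))
  tail j j<l = subst (T ∘ q) (+-suc y j) ∘ p⇒q (suc j) (s≤s j<l) ∘ subst (T ∘ p) (sym (+-suc x j))

interval-pred : ∀ {x l y} → suc x ≤ y × y < suc x + l → x ≤ y × y < x + suc l
interval-pred {x} {l} {y} (x<y , y<) = <⇒≤ x<y , subst (y <_) (sym (+-suc x l)) y<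

StrictlyIncreasing : ∀ {K} → (Fin K → ℕ) → Set
StrictlyIncreasing g = ∀ j j′ → toℕ j < toℕ j′ → g j < g j′

IncreasingWitnesses : (ℕ → Bool) → ℕ → ℕ → ℕ → Set
IncreasingWitnesses p x l K =
  Σ (Fin K → ℕ) λ g → StrictlyIncreasing g × (∀ j → x ≤ g j × g j < x + l) × (∀ j → T (p (g j)))

increasing-witnesses : ∀ p x l K → K ≤ count p x l → IncreasingWitnesses p x l K
increasing-witnesses p x l       zero    _  = (λ ()) , (λ ()) , (λ ()) , (λ ())
increasing-witnesses p x (suc l) (suc K) K≤ with p x in px
... | false = let g , incr , range , sat = increasing-witnesses p (suc x) l (suc K) K≤
              in g , incr , interval-pred ∘ range , sat
... | true with increasing-witnesses p (suc x) l K (≤-pred K≤)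
...   | g , incr , range , sat = x Fun.∷ g , incr′ , range′ , sat′
  where
  incr′ : StrictlyIncreasing (x Fun.∷ g)
  incr′ zero    (suc j′) _          = proj₁ (range j′)
  incr′ (suc j) (suc j′) (s≤s j<j′) = incr j j′ j<j′
  range′ : ∀ j → x ≤ (x Fun.∷ g) j × (x Fun.∷ g) j < x + suc l
  range′ zero    = ≤-refl , m<m+n x z<s
  range′ (suc j) = interval-pred (range j)
  sat′ : ∀ j → T (p ((x Fun.∷ g) j))
  sat′ zero    = subst T (sym px) _
  sat′ (suc j) = sat j

prefix-cong : ∀ {f g} a → (∀ b → f b ≡ g b) → prefix f a ≡ prefix g a
prefix-cong zero    _   = refl
prefix-cong (suc a) f≗g = cong₂ _+_ (prefix-cong a f≗g) (f≗g a)

prefix-mono : ∀ {f g} a → (∀ b → b < a → f b ≤ g b) → prefix f a ≤ prefix g a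
prefix-mono zero    _   = z≤n
prefix-mono (suc a) f≤g =
  +-mono-≤ (prefix-mono a (λ b b<a → f≤g b (m≤n⇒m≤1+n b<a))) (f≤g a ≤-refl)

prefix-monoʳ-≤ : ∀ f {b b′} → b ≤ b′ → prefix f b ≤ prefix f b′
prefix-monoʳ-≤ f {b′ = zero}   z≤n = ≤-refl
prefix-monoʳ-≤ f {b′ = suc b′} b≤1+b′ with m≤n⇒m<n∨m≡n b≤1+b′
... | inj₁ (s≤s b≤b′) = ≤-trans (prefix-monoʳ-≤ f b≤b′) (m≤m+n _ _)
... | inj₂ refl       = ≤-refl

prefix-+ : ∀ f g a → prefix (λ b → f b + g b) a ≡ prefix f a + prefix g a
prefix-+ f g zero    = refl
prefix-+ f g (suc a) rewrite prefix-+ f g a = interchange (prefix f a) (prefix g a) (f a) (g a)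

prefix-* : ∀ q f a → prefix (λ b → q * f b) a ≡ q * prefix f a
prefix-* q f zero    = sym (*-zeroʳ q)
prefix-* q f (suc a) rewrite prefix-* q f a = sym (*-distribˡ-+ q (prefix f a) (f a))

prefix-const : ∀ c a → prefix (λ _ → c) a ≡ a * c
prefix-const c zero    = refl
prefix-const c (suc a) rewrite prefix-const c a = +-comm (a * c) c

prefix-1 : ∀ a → prefix (λ _ → 1) a ≡ a
prefix-1 a = trans (prefix-const 1 a) (*-identityʳ a)

prefix-swap : ∀ (f : ℕ → ℕ → ℕ) a l →
              prefix (λ b → prefix (f b) l) a ≡ prefix (λ j → prefix (λ b → f b j) a) l
prefix-swap f zero    l = sym (trans (prefix-const 0 l) (*-zeroʳ l))
prefix-swap f (suc a) l rewrite prefix-swap f a l =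
  sym (prefix-+ (λ j → prefix (λ b → f b j) a) (λ j → f a j) l)

count≡prefix : ∀ p x l → count p x l ≡ prefix (λ j → indicator (p (x + j))) l
count≡prefix p x zero    = refl
count≡prefix p x (suc l) = begin
  count p x (suc l)                           ≡⟨ cong (count p x) (+-comm 1 l) ⟩
  count p x (l + 1)                           ≡⟨ count-++ p x l 1 ⟩
  count p x l + (indicator (p (x + l)) + 0)   ≡⟨ cong₂ _+_ (count≡prefix p x l) (+-identityʳ _) ⟩
  prefix (λ j → indicator (p (x + j))) (suc l) ∎
  where open ≡-Reasoning

count-swap : ∀ (G : ℕ → ℕ → Bool) x l a →
             prefix (λ b → count (G b) x l) a ≡ prefix (λ j → count (λ b → G b (x + j)) 0 a) l
count-swap G x l a = begin
  prefix (λ b → count (G b) x l) a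
    ≡⟨ prefix-cong a (λ b → count≡prefix (G b) x l) ⟩
  prefix (λ b → prefix (λ j → indicator (G b (x + j))) l) a
    ≡⟨ prefix-swap (λ b j → indicator (G b (x + j))) a l ⟩
  prefix (λ j → prefix (λ b → indicator (G b (x + j))) a) l
    ≡⟨ prefix-cong l (λ j → sym (count≡prefix (λ b → G b (x + j)) 0 a)) ⟩
  prefix (λ j → count (λ b → G b (x + j)) 0 a) l
    ∎
  where open ≡-Reasoning

count-blocks : ∀ p f a → count p 0 (prefix f a) ≡ prefix (λ b → count p (prefix f b) (f b)) a
count-blocks p f zero    = refl
count-blocks p f (suc a) rewrite count-++ p 0 (prefix f a) (f a) | count-blocks p f a = refl

-- Subsets of Fin n as Boolean predicates on ℕ

member : ∀ {n} → Subset n → ℕ → Bool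
member []      _       = false
member (b ∷ _) zero    = b
member (_ ∷ S) (suc i) = member S i

outside : ∀ {n} → Subset n → ℕ → Bool
outside S = not ∘ member S

member-toℕ : ∀ {n} (S : Subset n) (v : Fin n) → member S (toℕ v) ≡ lookup S v
member-toℕ (_ ∷ _) zero    = refl
member-toℕ (_ ∷ S) (suc v) = member-toℕ S v

∈⇒member : ∀ {n} {S : Subset n} {v} → v ∈ S → T (member S (toℕ v))
∈⇒member {S = S} {v} v∈S = from T-≡ (trans (member-toℕ S v) ([]=⇒lookup v∈S))

∣S∣+count-outside≡n : ∀ {n} (S : Subset n) → ∣ S ∣ + count (outside S) 0 n ≡ n
∣S∣+count-outside≡n         []          = refl
∣S∣+count-outside≡n {suc n} (true ∷ S)  rewrite count-shift (outside (true ∷ S)) 0 n =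
  cong suc (∣S∣+count-outside≡n S)
∣S∣+count-outside≡n {suc n} (false ∷ S) rewrite count-shift (outside (false ∷ S)) 0 n =
  trans (+-suc ∣ S ∣ _) (cong suc (∣S∣+count-outside≡n S))

fromPred : (ℕ → Bool) → (n : ℕ) → Subset n
fromPred p n = tabulate (p ∘ toℕ)

∈-fromPred : ∀ p {n} {v : Fin n} → v ∈ fromPred p n ⇔ T (p (toℕ v))
∈-fromPred p {v = v} = mk⇔
  (λ v∈ → from T-≡ (trans (sym (lookup∘tabulate (p ∘ toℕ) v)) ([]=⇒lookup v∈)))
  (λ pv → lookup⇒[]= v _ (trans (lookup∘tabulate (p ∘ toℕ) v) (to T-≡ pv)))

member-fromPred : ∀ p {n i} → i < n → member (fromPred p n) i ≡ p i
member-fromPred p {suc n} {zero}  _         = refl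
member-fromPred p {suc n} {suc i} (s≤s i<n) = member-fromPred (p ∘ suc) i<n

-- The upper bound

multipleOf : ℕ → ℕ → Bool
multipleOf m i = ⌊ m ∣? i ⌋

nonMultiples : ℕ → (n : ℕ) → Subset n
nonMultiples m = fromPred (not ∘ multipleOf m)

multiples-apart : ∀ {m i ℓ} → 0 < ℓ → ℓ < m → m ∣ i → m ∣ i + ℓ → ⊥
multiples-apart {ℓ = suc _} _ ℓ<m m∣i m∣i+ℓ = >⇒∤ ℓ<m (∣m+n∣m⇒∣n m∣i+ℓ m∣i)

count-multipleOf : ∀ m q x → suc m ∣ x → q ≤ count (multipleOf (suc m)) x (q * suc m)
count-multipleOf m zero    x _   = z≤n
count-multipleOf m (suc q) x m∣x = begin
  1 + q
    ≤⟨ +-mono-≤ (≤-trans (indicator-mono {c = multipleOf (suc m) x} (λ _ → fromWitness m∣x))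
                         (m≤m+n _ _))
                (count-multipleOf m q (x + suc m) (∣m∣n⇒∣m+n m∣x ∣-refl)) ⟩
  count (multipleOf (suc m)) x (suc m) + count (multipleOf (suc m)) (x + suc m) (q * suc m)
    ≡⟨ count-++ (multipleOf (suc m)) x (suc m) (q * suc m) ⟨
  count (multipleOf (suc m)) x (suc m + q * suc m)
    ∎
  where open ≤-Reasoning

count-outside-nonMultiples : ∀ m n → n / suc m ≤ count (outside (nonMultiples (suc m) n)) 0 n
count-outside-nonMultiples m n = begin
  n / suc m                                       ≤⟨ count-multipleOf m (n / suc m) 0 (suc m ∣0) ⟩
  count (multipleOf (suc m)) 0 (n / suc m * suc m) ≤⟨ count-monoʳ-≤ _ 0 (m/n*n≤m n (suc m)) ⟩
  count (multipleOf (suc m)) 0 n                   ≤⟨ count-mono _ _ 0 0 n multiple⇒outside ⟩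
  count (outside (nonMultiples (suc m) n)) 0 n     ∎
  where
  open ≤-Reasoning
  multiple⇒outside : ∀ j → j < n → T (multipleOf (suc m) j) → T (outside (nonMultiples (suc m) n) j)
  multiple⇒outside j j<n = subst T (sym (trans (cong not (member-fromPred _ j<n)) (not-involutive _)))

InBlock⇒<n : ∀ {n a} (P : EqualPartition n a) {b i} → b < a → InBlock P b i → i < n
InBlock⇒<n P b<a (_ , i<end) =
  <-≤-trans i<end (≤-trans (prefix-monoʳ-≤ (size P) b<a) (≤-reflexive (total P)))

nonMultiples-isTransversal : ∀ {k n a s} (P : EqualPartition n a) →
                             IsTransversal (suc k) n a s P (nonMultiples (suc s) n)
nonMultiples-isTransversal {n = n} {s = s} P F (ℓ , 0<ℓ , ℓ≤s , b , i , _ , b<a , inBlocks , ∈F) =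
  hit
  where
  i₀ = i zero
  i₀<n : i₀ < n
  i₀<n = InBlock⇒<n P (b<a zero) (proj₁ (inBlocks zero))
  i₀+ℓ<n : i₀ + ℓ < n
  i₀+ℓ<n = InBlock⇒<n P (b<a zero) (proj₂ (inBlocks zero))
  vertex : ∀ y (y<n : y < n) → y ≡ i₀ ⊎ y ≡ i₀ + ℓ → T (not (multipleOf (suc s) y)) →
           ∃ λ v → v ∈ F × v ∈ nonMultiples (suc s) n
  vertex y y<n y∈pair nonMultiple =
    fromℕ< y<n ,
    from (∈F _) (zero , subst (λ z → z ≡ i₀ ⊎ z ≡ i₀ + ℓ) (sym toℕv≡y) y∈pair) ,
    from (∈-fromPred (not ∘ multipleOf (suc s))) (subst (T ∘ not ∘ multipleOf (suc s)) (sym toℕv≡y) nonMultiple)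
    where toℕv≡y = toℕ-fromℕ< y<n
  hit : ∃ λ v → v ∈ F × v ∈ nonMultiples (suc s) n
  hit with multipleOf (suc s) i₀ in e₀ | multipleOf (suc s) (i₀ + ℓ) in e₁
  ... | false | _     = vertex i₀ i₀<n (inj₁ refl) (subst (T ∘ not) (sym e₀) _)
  ... | true  | false = vertex (i₀ + ℓ) i₀+ℓ<n (inj₂ refl) (subst (T ∘ not) (sym e₁) _)
  ... | true  | true  = ⊥-elim (multiples-apart 0<ℓ (s≤s ℓ≤s)
                          (toWitness {a? = suc s ∣? i₀} (subst T (sym e₀) _))
                          (toWitness {a? = suc s ∣? (i₀ + ℓ)} (subst T (sym e₁) _)))

transversalNumber-upper : ∀ {k n a s} (P : EqualPartition n a) {t} →
                             IsTransversalNumber (suc k) n a s P t → t + n / suc s ≤ n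
transversalNumber-upper {n = n} {s = s} P {t} (_ , minimal) = begin
  t + n / suc s                     ≤⟨ +-mono-≤ (minimal T₀ (nonMultiples-isTransversal P))
                                                 (count-outside-nonMultiples s n) ⟩
  ∣ T₀ ∣ + count (outside T₀) 0 n ≡⟨ ∣S∣+count-outside≡n T₀ ⟩
  n                                 ∎
  where
  open ≤-Reasoning
  T₀ = nonMultiples (suc s) n

-- The lower bound

RecordsGaps : (W G : ℕ → Bool) → ℕ → ℕ → Set
RecordsGaps W G lo hi =
  ∀ {y ℓ} → lo ≤ y → y + ℓ < hi → T (W y) → T (W (y + ℓ)) → T (G ℓ)

module _ {W G : ℕ → Bool} {lo hi : ℕ} (records : RecordsGaps W G lo hi) where

  window-count : ∀ {s} x m → lo ≤ x → x + m ≤ hi → m ≤ suc s →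
                 count W x m ≤ suc (count G 1 s)
  window-count x zero    _    _      _   = z≤n
  window-count x (suc m) lo≤x x+m≤hi m≤s with W x in Wx
  ... | false = window-count (suc x) m (m≤n⇒m≤1+n lo≤x) (subst (_≤ hi) (+-suc x m) x+m≤hi)
                             (m≤n⇒m≤1+n (≤-pred m≤s))
  ... | true  = s≤s (≤-trans (count-mono W G (suc x) 1 m gap) (count-monoʳ-≤ G 1 (≤-pred m≤s)))
    where
    gap : ∀ j → j < m → T (W (suc x + j)) → T (G (1 + j))
    gap j j<m = records lo≤x (<-≤-trans (+-monoʳ-< x (s≤s j<m)) x+m≤hi) (subst T (sym Wx) _)
              ∘ subst (T ∘ W) (sym (+-suc x j))

  chunk-count : ∀ {s} Q x l → lo ≤ x → x + l ≤ hi → l ≤ Q * s →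
                count W x l ≤ Q * suc (count G 1 s)
  chunk-count zero    x zero    _ _ _ = z≤n
  chunk-count {s} (suc Q) x l lo≤x x+l≤hi l≤ with l ≤? s
  ... | yes l≤s = ≤-trans (window-count x l lo≤x x+l≤hi (m≤n⇒m≤1+n l≤s)) (m≤m+n _ _)
  ... | no  l≰s with m≤n⇒∃[o]m+o≡n (≰⇒≥ l≰s)
  ...   | r , refl = begin
    count W x (s + r)                ≡⟨ count-++ W x s r ⟩
    count W x s + count W (x + s) r  ≤⟨ +-mono-≤ head rest ⟩
    suc Gs + Q * suc Gs              ∎
    where
    open ≤-Reasoning
    Gs = count G 1 s
    head : count W x s ≤ suc Gs
    head = window-count x s lo≤x (≤-trans (+-monoʳ-≤ x (m≤m+n s r)) x+l≤hi) (n≤1+n s)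
    rest : count W (x + s) r ≤ Q * suc Gs
    rest = chunk-count Q (x + s) r (≤-trans lo≤x (m≤m+n x s))
                       (subst (_≤ hi) (sym (+-assoc x s r)) x+l≤hi) (+-cancelˡ-≤ s r (Q * s) l≤)

pairPoint? : ∀ {k} ℓ (i : Fin k → ℕ) m → Dec (∃ λ j → m ≡ i j ⊎ m ≡ i j + ℓ)
pairPoint? ℓ i m = any? (λ j → (m ≟ i j) ⊎-dec (m ≟ i j + ℓ))

pairsAt : ∀ {k} n → ℕ → (Fin k → ℕ) → Subset n
pairsAt n ℓ i = fromPred (λ m → ⌊ pairPoint? ℓ i m ⌋) n

∈-pairsAt : ∀ {k n ℓ} {i : Fin k → ℕ} {v : Fin n} →
            v ∈ pairsAt n ℓ i ⇔ (∃ λ j → toℕ v ≡ i j ⊎ toℕ v ≡ i j + ℓ)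
∈-pairsAt {ℓ = ℓ} {i} {v} = mk⇔
  (toWitness {a? = pairPoint? ℓ i (toℕ v)} ∘ to (∈-fromPred isPairPoint))
  (from (∈-fromPred isPairPoint) ∘ fromWitness)
  where isPairPoint = λ m → ⌊ pairPoint? ℓ i m ⌋

outside-∉ : ∀ {n} {S : Subset n} {v y} → toℕ v ≡ y → T (outside S y) → v ∈ S → ⊥
outside-∉ refl out v∈S = subst T (to T-not-≡ out) (∈⇒member v∈S)

module _ {k n a s} (P : EqualPartition n a) {X : Subset n} (isTransversal : IsTransversal k n a s P X) where

  private
    W : ℕ → Bool
    W = outside X

    inBlock? : ∀ b i → Dec (InBlock P b i)
    inBlock? b i = (_ ≤? i) ×-dec (i <? _)

  GapAt : ℕ → ℕ → ℕ → Set
  GapAt b ℓ i = (InBlock P b i × InBlock P b (i + ℓ)) × (T (W i) × T (W (i + ℓ)))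

  gap? : ∀ b ℓ → Dec (∃ λ i → i < prefix (size P) (suc b) × GapAt b ℓ i)
  gap? b ℓ = anyUpTo? (λ i → (inBlock? b i ×-dec inBlock? b (i + ℓ)) ×-dec
                             (T? (W i) ×-dec T? (W (i + ℓ))))
                      (prefix (size P) (suc b))

  hasGap : ℕ → ℕ → Bool
  hasGap b ℓ = ⌊ gap? b ℓ ⌋

  gapCount : ℕ → ℕ
  gapCount b = count (hasGap b) 1 s

  hasGap-recordsGaps : ∀ b → RecordsGaps W (hasGap b) (prefix (size P) b) (prefix (size P) (suc b))
  hasGap-recordsGaps b {y} {ℓ} start≤y y+ℓ<end Wy Wy+ℓ =
    fromWitness {a? = gap? b ℓ}
      (y , y<end , ((start≤y , y<end) , (≤-trans start≤y (m≤m+n y ℓ) , y+ℓ<end)) , Wy , Wy+ℓ)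
    where
    y<end = ≤-<-trans (m≤m+n y ℓ) y+ℓ<end

  few-blocks-have-gap : ∀ {ℓ} → 1 ≤ ℓ → ℓ ≤ s → count (λ b → hasGap b ℓ) 0 a < k
  few-blocks-have-gap {ℓ} 1≤ℓ ℓ≤s =
    ≰⇒> (λ k≤count → avoiding-facet (increasing-witnesses (λ b → hasGap b ℓ) 0 a k k≤count))
    where
    avoiding-facet : IncreasingWitnesses (λ b → hasGap b ℓ) 0 a k → ⊥
    avoiding-facet (g , increasing , range , gaps) = avoids (isTransversal (pairsAt n ℓ i) facet)
      where
      gap : ∀ j → ∃ λ i → i < prefix (size P) (suc (g j)) × GapAt (g j) ℓ i
      gap j = toWitness {a? = gap? (g j) ℓ} (gaps j)
      i : Fin k → ℕ
      i j = proj₁ (gap j)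
      facet : IsFacet k n a s P (pairsAt n ℓ i)
      facet = ℓ , 1≤ℓ , ℓ≤s , g , i , increasing , proj₂ ∘ range ,
              (λ j → proj₁ (proj₂ (proj₂ (gap j)))) , (λ _ → ∈-pairsAt)
      outsides : ∀ j → T (W (i j)) × T (W (i j + ℓ))
      outsides j = proj₂ (proj₂ (proj₂ (gap j)))
      avoids : (∃ λ v → v ∈ pairsAt n ℓ i × v ∈ X) → ⊥
      avoids (v , v∈F , v∈X) with to ∈-pairsAt v∈F
      ... | j , inj₁ v≡i   = outside-∉ v≡i   (proj₁ (outsides j)) v∈X
      ... | j , inj₂ v≡i+ℓ = outside-∉ v≡i+ℓ (proj₂ (outsides j)) v∈X

  gapCount-sum≤ : prefix gapCount a ≤ s * pred k
  gapCount-sum≤ = begin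
    prefix gapCount a                                    ≡⟨ count-swap hasGap 1 s a ⟩
    prefix (λ j → count (λ b → hasGap b (suc j)) 0 a) s
      ≤⟨ prefix-mono s (λ j j<s → <⇒≤pred (few-blocks-have-gap (s≤s z≤n) j<s)) ⟩
    prefix (λ _ → pred k) s                              ≡⟨ prefix-const (pred k) s ⟩
    s * pred k                                           ∎
    where open ≤-Reasoning

  count-outside≤ : ∀ Q → (∀ b → b < a → size P b ≤ Q * s) →
                   count W 0 n ≤ Q * (a + s * pred k)
  count-outside≤ Q size≤ = begin
    count W 0 n                                          ≡⟨ cong (count W 0) (total P) ⟨
    count W 0 (prefix (size P) a)                        ≡⟨ count-blocks W (size P) a ⟩
    prefix (λ b → count W (prefix (size P) b) (size P b)) a
      ≤⟨ prefix-mono a (λ b b<a →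
           chunk-count (hasGap-recordsGaps b) Q _ _ ≤-refl ≤-refl (size≤ b b<a)) ⟩
    prefix (λ b → Q * suc (gapCount b)) a                ≡⟨ prefix-* Q _ a ⟩
    Q * prefix (λ b → 1 + gapCount b) a
      ≡⟨ cong (Q *_) (prefix-+ (λ _ → 1) gapCount a) ⟩
    Q * (prefix (λ _ → 1) a + prefix gapCount a)
      ≤⟨ *-monoʳ-≤ Q (+-mono-≤ (≤-reflexive (prefix-1 a)) gapCount-sum≤) ⟩
    Q * (a + s * pred k)                                 ∎
    where open ≤-Reasoning

transversalNumber-lower : ∀ {k n a s} (P : EqualPartition n a) {t} → IsTransversalNumber k n a s P t →
                       ∀ Q → (∀ b → b < a → size P b ≤ Q * s) → n ≤ t + Q * (a + s * pred k)
transversalNumber-lower {k} {n} {a} {s} P {t} ((X , isTransversal , ∣X∣≡t) , _) Q size≤ = begin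
  n                              ≡⟨ ∣S∣+count-outside≡n X ⟨
  ∣ X ∣ + count (outside X) 0 n
    ≤⟨ +-mono-≤ (≤-reflexive ∣X∣≡t) (count-outside≤ P isTransversal Q size≤) ⟩
  t + Q * (a + s * pred k)       ∎
  where open ≤-Reasoning

a*size≤n+a : ∀ {n a} (P : EqualPartition n a) {b} → b < a → a * size P b ≤ n + a
a*size≤n+a {n} {a} P {b} b<a = begin
  a * size P b                          ≡⟨ prefix-const (size P b) a ⟨
  prefix (λ _ → size P b) a
    ≤⟨ prefix-mono a (λ b′ b′<a → ≤-trans (balanced P b b′ b<a b′<a) (≤-reflexive (+-comm 1 _))) ⟩
  prefix (λ b′ → size P b′ + 1) a       ≡⟨ prefix-+ (size P) (λ _ → 1) a ⟩
  prefix (size P) a + prefix (λ _ → 1) a ≡⟨ cong₂ _+_ (total P) (prefix-1 a) ⟩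
  n + a                                 ∎
  where open ≤-Reasoning

n<[1+n/m]*m : ∀ n m .{{_ : NonZero m}} → n < suc (n / m) * m
n<[1+n/m]*m n m = begin-strict
  n                 ≡⟨ m≡m%n+[m/n]*n n m ⟩
  n % m + n / m * m <⟨ +-monoˡ-< (n / m * m) (m%n<n n m) ⟩
  suc (n / m) * m   ∎
  where open ≤-Reasoning

size≤[1+n/[a*s]]*s : ∀ {n a} (P : EqualPartition n a) s .{{_ : NonZero (a * s)}} {b} →
                     b < a → size P b ≤ suc (n / (a * s)) * s
size≤[1+n/[a*s]]*s {n} {a} P s {b} b<a = ≤-pred (*-cancelˡ-< a (size P b) (suc (Q * s)) (begin-strict
  a * size P b      ≤⟨ a*size≤n+a P b<a ⟩
  n + a             <⟨ +-monoˡ-< a (n<[1+n/m]*m n (a * s)) ⟩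
  Q * (a * s) + a   ≡⟨ q*[a*s]+a≡a*[1+q*s] Q a s ⟩
  a * suc (Q * s)   ∎))
  where
  open ≤-Reasoning
  Q = suc (n / (a * s))
  q*[a*s]+a≡a*[1+q*s] : ∀ q a s → q * (a * s) + a ≡ a * suc (q * s)
  q*[a*s]+a≡a*[1+q*s] = solve-∀

s*n≤s*t+2*[1+d*K]*n : ∀ {n t a s d K} .{{_ : NonZero (a * s)}} → a * s ≤ n → s ≤ d * a →
                      n ≤ t + suc (n / (a * s)) * (a + s * K) → s * n ≤ s * t + 2 * (1 + d * K) * n
s*n≤s*t+2*[1+d*K]*n {n} {t} {a} {s} {d} {K} as≤n s≤da n≤ = begin
  s * n                          ≤⟨ *-monoʳ-≤ s n≤ ⟩
  s * (t + Q * (a + s * K))      ≡⟨ *-distribˡ-+ s t _ ⟩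
  s * t + s * (Q * (a + s * K))  ≤⟨ +-monoʳ-≤ (s * t) missed≤ ⟩
  s * t + 2 * (1 + d * K) * n    ∎
  where
  open ≤-Reasoning
  Q = suc (n / (a * s))
  missed≤ : s * (Q * (a + s * K)) ≤ 2 * (1 + d * K) * n
  missed≤ = begin
    s * (Q * (a + s * K))
      ≤⟨ *-monoʳ-≤ s (*-monoʳ-≤ Q (+-monoʳ-≤ a (*-monoˡ-≤ K s≤da))) ⟩
    s * (Q * (a + d * a * K))  ≡⟨ regroup s Q a d K ⟩
    Q * (a * s) * (1 + d * K)  ≤⟨ *-monoˡ-≤ (1 + d * K) (+-mono-≤ as≤n (m/n*n≤m n (a * s))) ⟩
    (n + n) * (1 + d * K)      ≡⟨ double n (1 + d * K) ⟩
    2 * (1 + d * K) * n        ∎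
    where
    regroup : ∀ s Q a d K → s * (Q * (a + d * a * K)) ≡ Q * (a * s) * (1 + d * K)
    regroup = solve-∀
    double : ∀ n X → (n + n) * X ≡ 2 * X * n
    double = solve-∀

4*s*t+n≤4*s*n : ∀ {n t s} → 1 ≤ s → suc s ≤ n → t + n / suc s ≤ n →
                4 * s * t + n ≤ 4 * s * n
4*s*t+n≤4*s*n {n} {t} {s} 1≤s s<n t+q≤n = begin
  4 * s * t + n          ≤⟨ +-monoʳ-≤ (4 * s * t) n≤4sq ⟩
  4 * s * t + 4 * s * q  ≡⟨ *-distribˡ-+ (4 * s) t q ⟨
  4 * s * (t + q)        ≤⟨ *-monoʳ-≤ (4 * s) t+q≤n ⟩
  4 * s * n              ∎
  where
  open ≤-Reasoning
  q = n / suc s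
  n≤4sq : n ≤ 4 * s * q
  n≤4sq = begin
    n                  ≤⟨ <⇒≤ (n<[1+n/m]*m n (suc s)) ⟩
    suc q * suc s      ≤⟨ *-mono-≤ (+-monoˡ-≤ q (m≥n⇒m/n>0 s<n)) (+-monoˡ-≤ s 1≤s) ⟩
    (q + q) * (s + s)  ≡⟨ quadruple q s ⟩
    4 * s * q          ∎
    where
    quadruple : ∀ q s → (q + q) * (s + s) ≡ 4 * s * q
    quadruple = solve-∀

2*s*a≤n⇒a*s≤n×s<n : ∀ {n a s} → 1 ≤ a → 1 ≤ s → 2 * s * a ≤ n → a * s ≤ n × s < n
2*s*a≤n⇒a*s≤n×s<n {n} {a} {s} 1≤a 1≤s 2sa≤n =
  ≤-trans (m≤m+n (a * s) (a * s)) (≤-trans (≤-reflexive (double-as a s)) 2sa≤n) ,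
  <-≤-trans (m<m+n s 1≤s)
            (≤-trans (≤-reflexive (double-s s)) (≤-trans (*-monoʳ-≤ (2 * s) 1≤a) 2sa≤n))
  where
  double-as : ∀ a s → a * s + a * s ≡ 2 * s * a
  double-as = solve-∀
  double-s : ∀ s → s + s ≡ 2 * s * 1
  double-s = solve-∀

eventually-× : ∀ {P Q : ℕ → Set} → Eventually P → Eventually Q → Eventually (λ n → P n × Q n)
eventually-× (M , p) (N , q) =
  M + N , λ n M+N≤n → p n (≤-trans (m≤m+n M N) M+N≤n) , q n (≤-trans (m≤n+m N M) M+N≤n)

eventually-mono : ∀ {P Q : ℕ → Set} → (∀ {n} → P n → Q n) → Eventually P → Eventually Q
eventually-mono P⇒Q (N , p) = N , λ n N≤n → P⇒Q (p n N≤n)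

s≤s*⌊log₂s⌋ : ∀ {s} → 2 ≤ s → s ≤ s * ⌊log₂ s ⌋
s≤s*⌊log₂s⌋ {s} 2≤s =
  ≤-trans (≤-reflexive (sym (*-identityʳ s))) (*-monoʳ-≤ s (⌊log₂⌋-mono-≤ 2≤s))

proposition3p11 : (k : ℕ) → 2 ≤ k →
    (a s : ℕ → ℕ) →
    (∀ n → 1 ≤ a n) → (∀ n → 1 ≤ s n) →
    LittleOQuot a (λ n → n) (λ _ → 1) →
    LittleOQuot s (λ n → n) a →
    TendsToInfinity a → TendsToInfinity s →
    OmegaSLogS a s →
    (P : (n : ℕ) → EqualPartition n (a n)) →
    Σ ℕ λ c → Σ ℕ λ C → 1 ≤ c × 1 ≤ C × Eventually λ n →
      ∀ t → IsTransversalNumber k n (a n) (s n) (P n) t →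
        (s n * n ≤ s n * t + C * n) × (c * s n * t + n ≤ c * s n * n)
proposition3p11 (suc (suc k)) (s≤s (s≤s _)) a s a≥1 s≥1 _ s=o[n/a] _ s→∞ (d , _ , slogs≤da) P =
  4 , 2 * (1 + d * suc k) , s≤s z≤n , s≤s z≤n ,
  eventually-mono bounds (eventually-× (s=o[n/a] 2 (s≤s z≤n)) (eventually-× (s→∞ 2) slogs≤da))
  where
  bounds : ∀ {n} → 2 * s n * a n ≤ n × 2 ≤ s n × s n * ⌊log₂ s n ⌋ ≤ d * a n →
           ∀ t → IsTransversalNumber (suc (suc k)) n (a n) (s n) (P n) t →
           (s n * n ≤ s n * t + 2 * (1 + d * suc k) * n) × (4 * s n * t + n ≤ 4 * s n * n)
  bounds {n} (2sa≤n , 2≤s , slogs≤da) t τ with 2*s*a≤n⇒a*s≤n×s<n (a≥1 n) (s≥1 n) 2sa≤n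
  ... | as≤n , s<n =
    s*n≤s*t+2*[1+d*K]*n {d = d} {K = suc k} as≤n (≤-trans (s≤s*⌊log₂s⌋ 2≤s) slogs≤da)
      (transversalNumber-lower (P n) τ (suc (n / (a n * s n))) (λ b → size≤[1+n/[a*s]]*s (P n) (s n))) ,
    4*s*t+n≤4*s*n (s≥1 n) s<n (transversalNumber-upper (P n) τ)
    where
    instance
      as≢0 : NonZero (a n * s n)
      as≢0 = >-nonZero (*-mono-≤ (a≥1 n) (s≥1 n))
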